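{- Let $G$ be a finite simple graph and $H$ an induced subgraph of $G$. If $\chi(G)=\chi(G\setminus H)+\chi(H)$, then $\iota(G)\ge\iota(G\setminus H)+\iota(H)$.
   Context: $G\setminus H$ denotes the subgraph of $G$ induced on $V(G)\setminus V(H)$. The stinginess $\iota(G)$ is the maximum number of singleton color classes appearing in an optimal (i.e. $\chi(G)$-color) proper coloring of $G$. -}

module Defs where

open import Data.Nat using (ℕ; _≤_)
open import Data.Fin using (Fin)
open import Data.Fin.Properties using (_≟_)
open import Data.Fin.Subset using (Subset; _∈_; ⊤)
open import Data.Fin.Subset.Properties using (_∈?_)
open import Data.List using (List; length; filter; allFin)
open import Data.Product using (Σ; _×_; _,_)
open import Relation.Nullary using (¬_)
open import Relation.Nullary.Decidable using (_×-dec_)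
open import Relation.Binary.PropositionalEquality using (_≡_; _≢_)

record Graph : Set₁ where
  field
    n       : ℕ
    Adj     : Fin n → Fin n → Set
    sym     : ∀ {u v} → Adj u v → Adj v u
    irrefl  : ∀ {u} → ¬ Adj u u

open Graph public

-- The induced subgraph G[S] of G on the vertex set S is represented by
-- the pair (G , S).  G itself is G[⊤]; for H = G[S], G ∖ H = G[∁ S].

-- c is a proper k-coloring of G[S]  (values of c outside S are irrelevant).
Proper : (G : Graph) → Subset (n G) → (k : ℕ) → (Fin (n G) → Fin k) → Set
Proper G S k c = ∀ u v → u ∈ S → v ∈ S → Adj G u v → c u ≢ c v

IsChromatic : (G : Graph) → Subset (n G) → ℕ → Set
IsChromatic G S k =
  Σ (Fin (n G) → Fin k) (λ c → Proper G S k c)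
  × (∀ m (c : Fin (n G) → Fin m) → Proper G S m c → k ≤ m)

classSize : ∀ {m k} → Subset m → (Fin m → Fin k) → Fin k → ℕ
classSize {m} S c i = length (filter (λ v → (v ∈? S) ×-dec (c v ≟ i)) (allFin m))

singletons : ∀ {m k} → Subset m → (Fin m → Fin k) → ℕ
singletons {m} {k} S c =
  length (filter (λ i → Data.Nat._≟_ (classSize S c i) 1) (allFin k))

IsStinginess : (G : Graph) → Subset (n G) → ℕ → Set
IsStinginess G S s =
  Σ ℕ λ k → IsChromatic G S k
    × Σ (Fin (n G) → Fin k) (λ c → Proper G S k c × singletons S c ≡ s)
    × (∀ (c : Fin (n G) → Fin k) → Proper G S k c → singletons S c ≤ s)

-- Colour G ∖ H and H optimally with disjoint palettes.  The union is a proper colouring of G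
-- with χ(G ∖ H) + χ(H) = χ(G) colours, hence optimal, and its colour classes are exactly the
-- classes of the two parts; so its singleton classes number ι(G ∖ H) + ι(H), and ι(G) is at
-- least that.
module Submission where

open import Defs hiding (sym)
open import Data.Nat using (ℕ; suc; _+_; _≤_; _≟_)
open import Data.Nat.Properties using (≤-antisym; module ≤-Reasoning)
open import Data.Fin using (Fin; _↑ˡ_; _↑ʳ_; splitAt) renaming (zero to fzero; suc to fsuc)
open import Data.Fin.Properties using (↑ˡ-injective; ↑ʳ-injective; splitAt-↑ˡ; splitAt-↑ʳ)
open import Data.Fin.Subset using (Subset; ⊤; ∁; _∈_)
open import Data.Fin.Subset.Properties using (_∈?_; ∈⊤; x∉p⇒x∈∁p; x∈∁p⇒x∉p)
open import Data.List using (List; []; _∷_; _++_; length; filter; map; tabulate; allFin)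
open import Data.List.Properties using (length-++; filter-++; filter-≐; map-tabulate)
open import Data.Product using (_×_; _,_)
open import Function using (_∘_)
open import Relation.Nullary using (yes; no; contradiction)
open import Relation.Unary using (Decidable; _≐_)
open import Relation.Binary.PropositionalEquality
  using (_≡_; _≢_; _≗_; refl; sym; trans; cong; cong₂; subst; module ≡-Reasoning)

length-filter-map : ∀ {A B : Set} {P : B → Set} (P? : Decidable P) (f : A → B) (xs : List A) →
  length (filter P? (map f xs)) ≡ length (filter (P? ∘ f) xs)
length-filter-map P? f [] = refl
length-filter-map P? f (x ∷ xs) with P? (f x)
... | yes _ = cong suc (length-filter-map P? f xs)
... | no _  = length-filter-map P? f xs

length-filter-tabulate : ∀ {n} {A : Set} {P : A → Set} (P? : Decidable P) (f : Fin n → A) →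
  length (filter P? (tabulate f)) ≡ length (filter (P? ∘ f) (allFin n))
length-filter-tabulate P? f =
  trans (cong (length ∘ filter P?) (sym (map-tabulate (λ i → i) f)))
        (length-filter-map P? f (allFin _))

tabulate-+ : ∀ {A : Set} a {b} (f : Fin (a + b) → A) →
  tabulate f ≡ tabulate (f ∘ (_↑ˡ b)) ++ tabulate (f ∘ (a ↑ʳ_))
tabulate-+ 0       f = refl
tabulate-+ (suc a) f = cong (f fzero ∷_) (tabulate-+ a (f ∘ fsuc))

↑ˡ≢↑ʳ : ∀ {a b} (i : Fin a) (j : Fin b) → i ↑ˡ b ≢ a ↑ʳ j
↑ˡ≢↑ʳ {a} {b} i j eq
  with () ← trans (sym (splitAt-↑ˡ a i b)) (trans (cong (splitAt a) eq) (splitAt-↑ʳ a b j))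

module _ {m a b : ℕ} (S : Subset m) (c₁ : Fin m → Fin a) (c₂ : Fin m → Fin b) where

  glue : Fin m → Fin (a + b)
  glue v with v ∈? S
  ... | yes _ = a ↑ʳ c₂ v
  ... | no _  = c₁ v ↑ˡ b

  glue-class-↑ˡ : ∀ j → classSize ⊤ glue (j ↑ˡ b) ≡ classSize (∁ S) c₁ j
  glue-class-↑ˡ j = cong length (filter-≐ _ _ (into , out) (allFin m))
    where
    into : ∀ {v} → v ∈ ⊤ × glue v ≡ j ↑ˡ b → v ∈ ∁ S × c₁ v ≡ j
    into {v} (_ , eq) with v ∈? S
    ... | yes _  = contradiction (sym eq) (↑ˡ≢↑ʳ _ _)
    ... | no v∉S = x∉p⇒x∈∁p v∉S , ↑ˡ-injective b _ _ eq
    out : ∀ {v} → v ∈ ∁ S × c₁ v ≡ j → v ∈ ⊤ × glue v ≡ j ↑ˡ b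
    out {v} (v∈∁S , eq) with v ∈? S
    ... | yes v∈S = contradiction v∈S (x∈∁p⇒x∉p v∈∁S)
    ... | no _    = ∈⊤ , cong (_↑ˡ b) eq

  glue-class-↑ʳ : ∀ j → classSize ⊤ glue (a ↑ʳ j) ≡ classSize S c₂ j
  glue-class-↑ʳ j = cong length (filter-≐ _ _ (into , out) (allFin m))
    where
    into : ∀ {v} → v ∈ ⊤ × glue v ≡ a ↑ʳ j → v ∈ S × c₂ v ≡ j
    into {v} (_ , eq) with v ∈? S
    ... | yes v∈S = v∈S , ↑ʳ-injective a _ _ eq
    ... | no _    = contradiction eq (↑ˡ≢↑ʳ _ _)
    out : ∀ {v} → v ∈ S × c₂ v ≡ j → v ∈ ⊤ × glue v ≡ a ↑ʳ j
    out {v} (v∈S , eq) with v ∈? S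
    ... | yes _  = ∈⊤ , cong (a ↑ʳ_) eq
    ... | no v∉S = contradiction v∈S v∉S

  singletons-glue : singletons ⊤ glue ≡ singletons (∁ S) c₁ + singletons S c₂
  singletons-glue = begin
    length (filter single? (tabulate (λ i → i)))
      ≡⟨ cong (length ∘ filter single?) (tabulate-+ a (λ i → i)) ⟩
    length (filter single? (tabulate (_↑ˡ b) ++ tabulate (a ↑ʳ_)))
      ≡⟨ cong length (filter-++ single? (tabulate (_↑ˡ b)) _) ⟩
    length (filter single? (tabulate (_↑ˡ b)) ++ filter single? (tabulate (a ↑ʳ_)))
      ≡⟨ length-++ (filter single? (tabulate (_↑ˡ b))) ⟩
    length (filter single? (tabulate (_↑ˡ b))) + length (filter single? (tabulate (a ↑ʳ_)))
      ≡⟨ cong₂ _+_ (length-filter-tabulate single? (_↑ˡ b))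
                   (length-filter-tabulate single? (a ↑ʳ_)) ⟩
    length (filter (single? ∘ (_↑ˡ b)) (allFin a)) + length (filter (single? ∘ (a ↑ʳ_)) (allFin b))
      ≡⟨ cong₂ _+_ (cong length (filter-≐ _ _ (≗⇒≡1-≐ glue-class-↑ˡ) (allFin a)))
                   (cong length (filter-≐ _ _ (≗⇒≡1-≐ glue-class-↑ʳ) (allFin b))) ⟩
    singletons (∁ S) c₁ + singletons S c₂ ∎
    where
    open ≡-Reasoning
    single? : Decidable (λ i → classSize ⊤ glue i ≡ 1)
    single? i = classSize ⊤ glue i ≟ 1
    ≗⇒≡1-≐ : ∀ {k} {x y : Fin k → ℕ} → x ≗ y → (λ j → x j ≡ 1) ≐ (λ j → y j ≡ 1)
    ≗⇒≡1-≐ x≡y = (λ {j} → trans (sym (x≡y j))) , (λ {j} → trans (x≡y j))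

glue-proper : ∀ {a b} (G : Graph) (S : Subset (n G))
  {c₁ : Fin (n G) → Fin a} {c₂ : Fin (n G) → Fin b} →
  Proper G (∁ S) a c₁ → Proper G S b c₂ → Proper G ⊤ (a + b) (glue S c₁ c₂)
glue-proper {a} {b} G S p₁ p₂ u v _ _ u~v with u ∈? S | v ∈? S
... | yes u∈S | yes v∈S = p₂ u v u∈S v∈S u~v ∘ ↑ʳ-injective a _ _
... | no u∉S  | no v∉S  = p₁ u v (x∉p⇒x∈∁p u∉S) (x∉p⇒x∈∁p v∉S) u~v ∘ ↑ˡ-injective b _ _
... | yes _   | no _    = ↑ˡ≢↑ʳ _ _ ∘ sym
... | no _    | yes _   = ↑ˡ≢↑ʳ _ _

chromatic-unique : ∀ G S {k l} → IsChromatic G S k → IsChromatic G S l → k ≡ l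
chromatic-unique _ _ ((c , c-proper) , k-least) ((d , d-proper) , l-least) =
  ≤-antisym (k-least _ d d-proper) (l-least _ c c-proper)

singletons≤stinginess : ∀ G S {k s} → IsStinginess G S s → IsChromatic G S k →
  (c : Fin (n G) → Fin k) → Proper G S k c → singletons S c ≤ s
singletons≤stinginess G S (k′ , χ-k′ , _ , maximal) χ-k c c-proper
  with refl ← chromatic-unique G S χ-k′ χ-k = maximal c c-proper

lemma3p1 : (G : Graph) (S : Subset (n G))
    (χG χH χGH ιG ιH ιGH : ℕ) →
    IsChromatic G ⊤ χG → IsChromatic G S χH → IsChromatic G (∁ S) χGH →
    χG ≡ χGH + χH →
    IsStinginess G ⊤ ιG → IsStinginess G S ιH → IsStinginess G (∁ S) ιGH →
    ιGH + ιH ≤ ιG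
lemma3p1 G S χG χH χGH ιG ιH ιGH χ-G χ-H χ-GH χG≡χGH+χH ι-G
  (kH , χ-kH , (c₂ , c₂-proper , refl) , _) (kGH , χ-kGH , (c₁ , c₁-proper , refl) , _)
  with refl ← chromatic-unique G S χ-kH χ-H | refl ← chromatic-unique G (∁ S) χ-kGH χ-GH = begin
    singletons (∁ S) c₁ + singletons S c₂ ≡⟨ sym (singletons-glue S c₁ c₂) ⟩
    singletons ⊤ (glue S c₁ c₂)           ≤⟨ singletons≤stinginess G ⊤ ι-G χ-glue (glue S c₁ c₂)
                                                (glue-proper G S c₁-proper c₂-proper) ⟩
    ιG                                    ∎
  where
  open ≤-Reasoning
  χ-glue : IsChromatic G ⊤ (kGH + kH)
  χ-glue = subst (IsChromatic G ⊤) χG≡χGH+χH χ-G
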